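{- Let $M=(E,\mathcal{B})$ be a uniformly dense matroid. If $M$ contains a coloop, then every element of $E$ is a coloop. If $M$ contains a loop, then every element of $E$ is a loop.
   Context: Here a matroid $M=(E,\mathcal{B})$ is a collection $\mathcal{B}$ of subsets (bases) of a finite set $E$ satisfying the basis exchange axiom (loops allowed). A coloop is an element contained in every basis; a loop is an element contained in no basis. $M$ is uniformly dense if there exists a nonzero nonnegative measure $\mu$ on $\mathcal{B}$ such that $\mu(\{B\in\mathcal{B}: e\in B\})$ is the same for all $e\in E$; for loopless matroids this is equivalent to $|A|/\operatorname{rank}(A)\le |E|/\operatorname{rank}(E)$ for all nonempty $A\subseteq E$, where $\operatorname{rank}(A)=\max_{B\in\mathcal{B}}|B\cap A|$.
   Formalization: The measure μ witnessing that M is uniformly dense takes values in the rationals rather than the reals. -}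

module Defs where

open import Data.Nat using (ℕ)
open import Data.Fin using (Fin)
open import Data.Fin.Subset using (Subset; _∈_; _∉_; inside; outside)
open import Data.Fin.Subset.Properties using (_∈?_)
open import Data.Vec using (_[_]≔_)
open import Data.List using (List; []; map; filter; foldr)
open import Data.List.Relation.Unary.Unique.Propositional using (Unique)
import Data.List.Membership.Propositional as LM
open import Data.Product using (Σ; _×_)
open import Data.Rational using (ℚ; 0ℚ; _+_; _≤_)
open import Relation.Binary.PropositionalEquality using (_≡_; _≢_)

-- Ground set E = Fin n; a subset of E is a 'Subset n' (characteristic vector).
record Matroid (n : ℕ) : Set where
  field
    bases    : List (Subset n)
    unique   : Unique bases
    nonempty : bases ≢ []
    exchange : ∀ {B₁ B₂} → B₁ LM.∈ bases → B₂ LM.∈ bases →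
               ∀ (e : Fin n) → e ∈ B₁ → e ∉ B₂ →
               Σ (Fin n) λ f → f ∈ B₂ × f ∉ B₁ ×
                 (((B₁ [ e ]≔ outside) [ f ]≔ inside) LM.∈ bases)

open Matroid public

sumℚ : List ℚ → ℚ
sumℚ = foldr _+_ 0ℚ

totalMass : ∀ {n} → Matroid n → (Subset n → ℚ) → ℚ
totalMass M μ = sumℚ (map μ (bases M))

massContaining : ∀ {n} → Matroid n → (Subset n → ℚ) → Fin n → ℚ
massContaining M μ e = sumℚ (map μ (filter (e ∈?_) (bases M)))

-- A measure on 𝓑 is a weight function on the bases (values off 𝓑 are irrelevant).
UniformlyDense : ∀ {n} → Matroid n → Set
UniformlyDense {n} M =
  Σ (Subset n → ℚ) λ μ →
    (∀ {B} → B LM.∈ bases M → 0ℚ ≤ μ B) ×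
    (totalMass M μ ≢ 0ℚ) ×
    (∀ (e e′ : Fin n) → massContaining M μ e ≡ massContaining M μ e′)

IsColoop : ∀ {n} → Matroid n → Fin n → Set
IsColoop M e = ∀ {B} → B LM.∈ bases M → e ∈ B

IsLoop : ∀ {n} → Matroid n → Fin n → Set
IsLoop M e = ∀ {B} → B LM.∈ bases M → e ∉ B

{-# OPTIONS --safe #-}
-- Fix a base B₀ of positive weight. A coloop has mass μ(𝓑), so by uniformity every
-- element does; a base of positive weight then cannot miss any element, so B₀ = E.
-- Dually, a loop has mass 0, so every element has mass 0 and B₀ = ∅. Finally, exchanging
-- out of the base E (into the base ∅) would need an element outside E (inside ∅), so
-- every element is a coloop (a loop).
module Submission where

open import Defs
open import Data.Nat using (ℕ)
open import Data.Fin using (Fin)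
open import Data.Fin.Subset using (Subset; _∈_; _∉_)
open import Data.Fin.Subset.Properties using (_∈?_)
open import Data.List using (List; []; _∷_; map; filter)
open import Data.List.Properties using (filter-all; filter-none)
open import Data.List.Relation.Unary.All as All using (All; []; _∷_)
import Data.List.Relation.Unary.All.Properties as All
open import Data.List.Relation.Unary.Any as Any using (Any; here; there)
import Data.List.Relation.Unary.Any.Properties as Any
import Data.List.Membership.Propositional as LM
open import Data.List.Membership.Propositional.Properties using (∈-map⁺; ∈-filter⁺)
open import Data.Product using (Σ; ∃-syntax; _×_; _,_)
open import Data.Rational using (ℚ; 0ℚ; _+_; _≤_; _<_)
open import Data.Rational.Properties
open import Algebra.Bundles using (module CommutativeMonoid)
open import Algebra.Properties.CommutativeSemigroup (CommutativeMonoid.commutativeSemigroup +-0-commutativeMonoid)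
  using (x∙yz≈y∙xz)
open import Algebra.Properties.Group +-0-group using (identityʳ-unique)
open import Relation.Nullary using (¬_; yes; no)
open import Relation.Nullary.Decidable using (decidable-stable)
open import Relation.Unary using (Pred; Decidable)
open import Relation.Unary.Properties using (∁?)
open import Function using (_∘_)
open import Relation.Binary.PropositionalEquality using (_≡_; _≢_; refl; sym; trans; cong; subst)

<⇒≱ : ∀ {p q} → p < q → ¬ q ≤ p
<⇒≱ p<q q≤p = <-irrefl refl (<-≤-trans p<q q≤p)

sumℚ-nonneg : ∀ {xs} → All (0ℚ ≤_) xs → 0ℚ ≤ sumℚ xs
sumℚ-nonneg []            = ≤-refl
sumℚ-nonneg (x≥0 ∷ xs≥0) = +-mono-≤ x≥0 (sumℚ-nonneg xs≥0)

∈⇒≤sumℚ : ∀ {x xs} → All (0ℚ ≤_) xs → x LM.∈ xs → x ≤ sumℚ xs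
∈⇒≤sumℚ {x} {_ ∷ xs} (_ ∷ xs≥0) (here refl) =
  subst (_≤ x + sumℚ xs) (+-identityʳ x) (+-monoʳ-≤ x (sumℚ-nonneg xs≥0))
∈⇒≤sumℚ {x} {y ∷ xs} (y≥0 ∷ xs≥0) (there x∈xs) =
  subst (_≤ y + sumℚ xs) (+-identityˡ x) (+-mono-≤ y≥0 (∈⇒≤sumℚ xs≥0 x∈xs))

sumℚ-zero : ∀ {xs} → All (_≡ 0ℚ) xs → sumℚ xs ≡ 0ℚ
sumℚ-zero []             = refl
sumℚ-zero (refl ∷ xs≡0) = trans (cong (0ℚ +_) (sumℚ-zero xs≡0)) (+-identityˡ 0ℚ)

sumℚ≢0⇒positive : ∀ {xs} → All (0ℚ ≤_) xs → sumℚ xs ≢ 0ℚ → Any (0ℚ <_) xs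
sumℚ≢0⇒positive {xs} xs≥0 sum≢0 =
  Any.map ≰⇒> (All.¬All⇒Any¬ (_≤? 0ℚ) xs λ xs≤0 →
    sum≢0 (sumℚ-zero (All.zipWith (λ (x≤0 , x≥0) → ≤-antisym x≤0 x≥0) (xs≤0 , xs≥0))))

module _ {a p} {A : Set a} {P : Pred A p} (P? : Decidable P) (w : A → ℚ) where

  private
    Σ⁺ Σ⁻ : List A → ℚ
    Σ⁺ xs = sumℚ (map w (filter P? xs))
    Σ⁻ xs = sumℚ (map w (filter (∁? P?) xs))

  sumℚ-filter-split : ∀ xs → Σ⁺ xs + Σ⁻ xs ≡ sumℚ (map w xs)
  sumℚ-filter-split []       = +-identityˡ 0ℚ
  sumℚ-filter-split (x ∷ xs) with P? x
  ... | yes _ = trans (+-assoc (w x) (Σ⁺ xs) (Σ⁻ xs)) (cong (w x +_) (sumℚ-filter-split xs))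
  ... | no  _ = trans (x∙yz≈y∙xz (Σ⁺ xs) (w x) (Σ⁻ xs)) (cong (w x +_) (sumℚ-filter-split xs))

  sumℚ-filter≡0⇒nonpos : ∀ {x xs} → All (λ y → 0ℚ ≤ w y) xs → Σ⁺ xs ≡ 0ℚ →
                          x LM.∈ xs → P x → w x ≤ 0ℚ
  sumℚ-filter≡0⇒nonpos {x} xs≥0 sum≡0 x∈xs Px =
    subst (w x ≤_) sum≡0 (∈⇒≤sumℚ (All.map⁺ (All.filter⁺ P? xs≥0)) (∈-map⁺ w (∈-filter⁺ P? x∈xs Px)))

massAvoiding : ∀ {n} → Matroid n → (Subset n → ℚ) → Fin n → ℚ
massAvoiding M μ e = sumℚ (map μ (filter (∁? (e ∈?_)) (bases M)))

module _ {n} (M : Matroid n) where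

  fullBase⇒coloop : ∀ {B₀} → B₀ LM.∈ bases M → (∀ f → f ∈ B₀) → ∀ e → IsColoop M e
  fullBase⇒coloop B₀∈ B₀-full e {B} B∈ = decidable-stable (e ∈? B) λ e∉B →
    let (f , _ , f∉B₀ , _) = exchange M B₀∈ B∈ e (B₀-full e) e∉B in f∉B₀ (B₀-full f)

  emptyBase⇒loop : ∀ {B₀} → B₀ LM.∈ bases M → (∀ f → f ∉ B₀) → ∀ e → IsLoop M e
  emptyBase⇒loop B₀∈ B₀-empty e B∈ e∈B =
    let (f , f∈B₀ , _) = exchange M B∈ B₀∈ e e∈B (B₀-empty e) in B₀-empty f f∈B₀

  module _ (μ : Subset n → ℚ) where

    massContaining+massAvoiding : ∀ e → massContaining M μ e + massAvoiding M μ e ≡ totalMass M μ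
    massContaining+massAvoiding e = sumℚ-filter-split (e ∈?_) μ (bases M)

    coloop⇒massContaining≡totalMass : ∀ {e} → IsColoop M e → massContaining M μ e ≡ totalMass M μ
    coloop⇒massContaining≡totalMass {e} e-coloop =
      cong (sumℚ ∘ map μ) (filter-all (e ∈?_) (All.tabulate e-coloop))

    loop⇒massContaining≡0 : ∀ {e} → IsLoop M e → massContaining M μ e ≡ 0ℚ
    loop⇒massContaining≡0 {e} e-loop =
      cong (sumℚ ∘ map μ) (filter-none (e ∈?_) (All.tabulate e-loop))

  module _ {μ : Subset n → ℚ} (μ≥0 : ∀ {B} → B LM.∈ bases M → 0ℚ ≤ μ B) where

    private
      μ≥0-all : All (λ B → 0ℚ ≤ μ B) (bases M)
      μ≥0-all = All.tabulate μ≥0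

    positiveBase : totalMass M μ ≢ 0ℚ → ∃[ B ] B LM.∈ bases M × 0ℚ < μ B
    positiveBase total≢0 = LM.find (Any.map⁻ (sumℚ≢0⇒positive (All.map⁺ μ≥0-all) total≢0))

    massContaining≡0⇒∉positiveBase : ∀ {e B} → massContaining M μ e ≡ 0ℚ →
                                     B LM.∈ bases M → 0ℚ < μ B → e ∉ B
    massContaining≡0⇒∉positiveBase {e} mass≡0 B∈ μB>0 e∈B =
      <⇒≱ μB>0 (sumℚ-filter≡0⇒nonpos (e ∈?_) μ μ≥0-all mass≡0 B∈ e∈B)

    massContaining≡totalMass⇒∈positiveBase : ∀ {e B} → massContaining M μ e ≡ totalMass M μ →
                                             B LM.∈ bases M → 0ℚ < μ B → e ∈ B
    massContaining≡totalMass⇒∈positiveBase {e} {B} mass≡total B∈ μB>0 =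
      decidable-stable (e ∈? B) λ e∉B →
        <⇒≱ μB>0 (sumℚ-filter≡0⇒nonpos (∁? (e ∈?_)) μ μ≥0-all avoiding≡0 B∈ e∉B)
      where
      avoiding≡0 : massAvoiding M μ e ≡ 0ℚ
      avoiding≡0 = identityʳ-unique _ _ (trans (massContaining+massAvoiding μ e) (sym mass≡total))

theorem2p5 : ∀ {n : ℕ} (M : Matroid n) → UniformlyDense M →
    ((Σ (Fin n) λ e → IsColoop M e) → ∀ (e : Fin n) → IsColoop M e) ×
    ((Σ (Fin n) λ e → IsLoop M e) → ∀ (e : Fin n) → IsLoop M e)
theorem2p5 M (μ , μ≥0 , total≢0 , uniform) =
  let (B₀ , B₀∈ , μB₀>0) = positiveBase M μ≥0 total≢0 in
    (λ (e₀ , e₀-coloop) → fullBase⇒coloop M B₀∈ λ f →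
       massContaining≡totalMass⇒∈positiveBase M μ≥0
         (trans (uniform f e₀) (coloop⇒massContaining≡totalMass M μ e₀-coloop)) B₀∈ μB₀>0)
  , (λ (e₀ , e₀-loop) → emptyBase⇒loop M B₀∈ λ f →
       massContaining≡0⇒∉positiveBase M μ≥0
         (trans (uniform f e₀) (loop⇒massContaining≡0 M μ e₀-loop)) B₀∈ μB₀>0)
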